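{- Let $\mathcal H$ be the complete $3$-uniform hypergraph on a $12$-element vertex set $V$, with each edge (each $3$-subset of $V$) colored by one of three colors $c_1,c_2,c_3$, and suppose $\mathcal H$ contains no $4$ pairwise disjoint edges using at most two colors. If $S_1,S_2\subseteq V$ are $6$-element sets, each monochromatic, with $|S_1\cap S_2|\le 4$, then the color of $S_1$ differs from the color of $S_2$.
   Context: A $6$-element set $S\subseteq V$ is monochromatic (spans a monochromatic $K_6^3$) if all $3$-subsets of $S$ have the same color, called the color of $S$. -}

module Defs where

open import Data.Nat using (ℕ; _≤_)
open import Data.Fin using (Fin)
open import Data.Fin.Subset using (Subset; _⊆_; _∩_; ∣_∣; ⊥)
open import Data.Product using (_×_; ∃; ∃-syntax)
open import Data.Sum using (_⊎_)
open import Relation.Binary.PropositionalEquality using (_≡_)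
open import Relation.Nullary using (¬_)

V : Set
V = Fin 12

-- Colours c₁,c₂,c₃ are the elements of Fin 3.  The colouring is a function
-- on all subsets; only its values on 3-element subsets are ever used.
Colouring : Set
Colouring = Subset 12 → Fin 3

IsEdge : Subset 12 → Set
IsEdge e = ∣ e ∣ ≡ 3

Disjoint : Subset 12 → Subset 12 → Set
Disjoint p q = p ∩ q ≡ ⊥

FourDisjointTwoColoured : Colouring → Set
FourDisjointTwoColoured c =
  ∃[ e₁ ] ∃[ e₂ ] ∃[ e₃ ] ∃[ e₄ ]
    (IsEdge e₁ × IsEdge e₂ × IsEdge e₃ × IsEdge e₄)
  × (Disjoint e₁ e₂ × Disjoint e₁ e₃ × Disjoint e₁ e₄
     × Disjoint e₂ e₃ × Disjoint e₂ e₄ × Disjoint e₃ e₄)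
  × (∃[ x ] ∃[ y ]
       ((c e₁ ≡ x ⊎ c e₁ ≡ y) × (c e₂ ≡ x ⊎ c e₂ ≡ y)
      × (c e₃ ≡ x ⊎ c e₃ ≡ y) × (c e₄ ≡ x ⊎ c e₄ ≡ y)))

Monochromatic : Colouring → Subset 12 → Fin 3 → Set
Monochromatic c S k =
  ∣ S ∣ ≡ 6 × (∀ T → T ⊆ S → IsEdge T → c T ≡ k)

module Submission where

-- Write I = S₁ ∩ S₂ and let k be the common colour.  The basic observation
-- (threeSameColour) is that three pairwise disjoint k-coloured edges already
-- give the forbidden configuration: on 12 vertices their complement is a
-- fourth disjoint edge, and only the colours k and its colour occur.
--   * If |I| ≤ 3, then S₁ splits into two k-edges and S₂ ─ S₁ has at least
--     three vertices, which form a third k-edge.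
--   * If |I| = 4, then U = S₁ ∪ S₂ has 8 vertices and its complement 4.  Any
--     k-edge E with a vertex outside U leaves room for a k-edge inside S₁ and
--     a k-edge inside S₂ disjoint from E and each other (kEdgeMeetingOutside).
--     On the other hand U and its complement can be packed by four disjoint
--     edges each meeting the complement (packing); if none of them has
--     colour k, all four use the two remaining colours (fourAvoiding).

open import Defs
open import Data.Nat using (ℕ; zero; suc; _≤_; _+_; _*_; _∸_; z≤n; s≤s)
open import Data.Nat.Properties
  using (+-suc; +-identityʳ; +-cancelˡ-≡; +-cancelʳ-≡; +-cancelˡ-≤; +-monoˡ-≤;
         ≤-trans; ≤-reflexive; n≤1+n; m≤n⇒m<n∨m≡n; m≤n+o⇒m∸n≤o;
         m+[n∸m]≡n; module ≤-Reasoning)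
open import Data.Fin using (Fin; zero; suc)
open import Data.Fin.Properties using (_≟_; any?)
open import Data.Fin.Subset
  using (Subset; _∩_; _∪_; _─_; _-_; ∁; ⁅_⁆; _∈_; _∉_; _⊆_; ⊥; ∣_∣; inside; outside)
open import Data.Fin.Subset.Properties
  using (Empty-unique; x∈p∩q⁺; x∈p∩q⁻; x∈p∪q⁺; x∈p∪q⁻; x∈p∧x∉q⇒x∈p─q;
         x∈p∧x≢y⇒x∈p-y; x∈p⇒∣p-x∣<∣p∣; x∈⁅x⁆; x∈⁅y⁆⇒x≡y; ∣⁅x⁆∣≡1; x∈∁p⇒x∉p;
         ∣∁p∣≡n∸∣p∣; ∣⊥∣≡0; ∣p─q∣≤∣p∣; p⊆q⇒∣p∣≤∣q∣; p─q⊆p; p∩q⊆q; p⊆p∪q;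
         q⊆p∪q; ⊆-refl; ⊆-trans; ⊆-min; ⊆-antisym; in⊆in; out⊆;
         ∩-comm; _∈?_)
open import Data.Vec.Base using ([]; _∷_; here; there)
open import Data.Product using (_×_; _,_; ∃; ∃₂)
open import Data.Sum using (_⊎_; inj₁; inj₂)
open import Data.Empty using (⊥-elim)
open import Relation.Binary.PropositionalEquality
  using (_≡_; _≢_; refl; sym; trans; cong; cong₂; subst; subst₂; module ≡-Reasoning)
open import Relation.Nullary using (¬_; Dec; yes; no)

x∈p─q⇒x∉q : ∀ {n} {x : Fin n} (p q : Subset n) → x ∈ p ─ q → x ∉ q
x∈p─q⇒x∉q (_ ∷ p) (outside ∷ q) (there x∈p─q) (there x∈q) = x∈p─q⇒x∉q p q x∈p─q x∈q
x∈p─q⇒x∉q (_ ∷ p) (inside ∷ q)  (there x∈p─q) (there x∈q) = x∈p─q⇒x∉q p q x∈p─q x∈q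

module _ {n : ℕ} where

  -- Pointwise disjointness: easier to build and transport than p ∩ q ≡ ⊥.
  Dj : Subset n → Subset n → Set
  Dj p q = ∀ {x} → x ∈ p → x ∉ q

  Dj⇒Disjoint : {p q : Subset n} → Dj p q → p ∩ q ≡ ⊥
  Dj⇒Disjoint {p} {q} d =
    Empty-unique λ (x , x∈p∩q) → let (x∈p , x∈q) = x∈p∩q⁻ p q x∈p∩q in d x∈p x∈q

  Dj-sym : {p q : Subset n} → Dj p q → Dj q p
  Dj-sym d x∈q x∈p = d x∈p x∈q

  Dj-⊆ : {p q p′ q′ : Subset n} → p′ ⊆ p → q′ ⊆ q → Dj p q → Dj p′ q′
  Dj-⊆ p′⊆p q′⊆q d x∈p′ x∈q′ = d (p′⊆p x∈p′) (q′⊆q x∈q′)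

  Dj-∪ˡ : {p q r : Subset n} → Dj p r → Dj q r → Dj (p ∪ q) r
  Dj-∪ˡ {p} {q} dp dq x∈p∪q with x∈p∪q⁻ p q x∈p∪q
  ... | inj₁ x∈p = dp x∈p
  ... | inj₂ x∈q = dq x∈q

  Dj-∪ʳ : {p q r : Subset n} → Dj r p → Dj r q → Dj r (p ∪ q)
  Dj-∪ʳ dp dq = Dj-sym (Dj-∪ˡ (Dj-sym dp) (Dj-sym dq))

  Dj-─ : {p q : Subset n} → Dj q (p ─ q)
  Dj-─ {p} {q} x∈q x∈p─q = x∈p─q⇒x∉q p q x∈p─q x∈q

  Dj-∁ : {p q : Subset n} → p ⊆ q → Dj p (∁ q)
  Dj-∁ p⊆q x∈p x∈∁q = x∈∁p⇒x∉p x∈∁q (p⊆q x∈p)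

  ⊆-∪ : {p q r : Subset n} → p ⊆ r → q ⊆ r → p ∪ q ⊆ r
  ⊆-∪ {p} {q} p⊆r q⊆r x∈p∪q with x∈p∪q⁻ p q x∈p∪q
  ... | inj₁ x∈p = p⊆r x∈p
  ... | inj₂ x∈q = q⊆r x∈q

  ─-monoˡ : {p q r : Subset n} → p ⊆ q → p ─ r ⊆ q ─ r
  ─-monoˡ {p} {q} {r} p⊆q x∈p─r =
    x∈p∧x∉q⇒x∈p─q (p⊆q (p─q⊆p p r x∈p─r)) (x∈p─q⇒x∉q p r x∈p─r)

  ⁅x⁆⊆p : ∀ {x} {p : Subset n} → x ∈ p → ⁅ x ⁆ ⊆ p
  ⁅x⁆⊆p {x} {p} x∈p y∈⁅x⁆ = subst (_∈ p) (sym (x∈⁅y⁆⇒x≡y x y∈⁅x⁆)) x∈p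

∣p∪q∣+∣p∩q∣ : ∀ {n} (p q : Subset n) → ∣ p ∪ q ∣ + ∣ p ∩ q ∣ ≡ ∣ p ∣ + ∣ q ∣
∣p∪q∣+∣p∩q∣ [] [] = refl
∣p∪q∣+∣p∩q∣ (inside ∷ p) (inside ∷ q) =
  cong suc (trans (+-suc ∣ p ∪ q ∣ ∣ p ∩ q ∣)
                  (trans (cong suc (∣p∪q∣+∣p∩q∣ p q)) (sym (+-suc ∣ p ∣ ∣ q ∣))))
∣p∪q∣+∣p∩q∣ (inside ∷ p) (outside ∷ q) = cong suc (∣p∪q∣+∣p∩q∣ p q)
∣p∪q∣+∣p∩q∣ (outside ∷ p) (inside ∷ q) =
  trans (cong suc (∣p∪q∣+∣p∩q∣ p q)) (sym (+-suc ∣ p ∣ ∣ q ∣))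
∣p∪q∣+∣p∩q∣ (outside ∷ p) (outside ∷ q) = ∣p∪q∣+∣p∩q∣ p q

∣p∪q∣≡∣p∣+∣q∣ : ∀ {n} {p q : Subset n} → Dj p q → ∣ p ∪ q ∣ ≡ ∣ p ∣ + ∣ q ∣
∣p∪q∣≡∣p∣+∣q∣ {n} {p} {q} d = begin
  ∣ p ∪ q ∣                 ≡⟨ sym (+-identityʳ _) ⟩
  ∣ p ∪ q ∣ + 0             ≡⟨ cong (∣ p ∪ q ∣ +_) (sym (trans (cong ∣_∣ (Dj⇒Disjoint d)) (∣⊥∣≡0 n))) ⟩
  ∣ p ∪ q ∣ + ∣ p ∩ q ∣     ≡⟨ ∣p∪q∣+∣p∩q∣ p q ⟩
  ∣ p ∣ + ∣ q ∣             ∎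
  where open ≡-Reasoning

∣p∣≡∣p∩q∣+∣p─q∣ : ∀ {n} (p q : Subset n) → ∣ p ∣ ≡ ∣ p ∩ q ∣ + ∣ p ─ q ∣
∣p∣≡∣p∩q∣+∣p─q∣ [] [] = refl
∣p∣≡∣p∩q∣+∣p─q∣ (inside ∷ p) (inside ∷ q) = cong suc (∣p∣≡∣p∩q∣+∣p─q∣ p q)
∣p∣≡∣p∩q∣+∣p─q∣ (inside ∷ p) (outside ∷ q) =
  trans (cong suc (∣p∣≡∣p∩q∣+∣p─q∣ p q)) (sym (+-suc ∣ p ∩ q ∣ ∣ p ─ q ∣))
∣p∣≡∣p∩q∣+∣p─q∣ (outside ∷ p) (inside ∷ q)  = ∣p∣≡∣p∩q∣+∣p─q∣ p q
∣p∣≡∣p∩q∣+∣p─q∣ (outside ∷ p) (outside ∷ q) = ∣p∣≡∣p∩q∣+∣p─q∣ p q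

∣p∣≡∣q∣+∣p─q∣ : ∀ {n} {p q : Subset n} → q ⊆ p → ∣ p ∣ ≡ ∣ q ∣ + ∣ p ─ q ∣
∣p∣≡∣q∣+∣p─q∣ {p = p} {q} q⊆p =
  trans (∣p∣≡∣p∩q∣+∣p─q∣ p q) (cong (λ r → ∣ r ∣ + ∣ p ─ q ∣) p∩q≡q)
  where
  p∩q≡q = ⊆-antisym (p∩q⊆q p q) (λ x∈q → x∈p∩q⁺ (q⊆p x∈q , x∈q))

shrink : ∀ {n m k} {p q : Subset n} → q ⊆ p → ∣ q ∣ ≡ m → m + k ≤ ∣ p ∣ → k ≤ ∣ p ─ q ∣
shrink {m = m} {k} q⊆p ∣q∣ m+k≤∣p∣ =
  +-cancelˡ-≤ m k _ (subst (m + k ≤_) (trans (∣p∣≡∣q∣+∣p─q∣ q⊆p) (cong (_+ _) ∣q∣)) m+k≤∣p∣)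

removeProtruding : ∀ {n} {x} {p q : Subset n} → x ∈ q → x ∉ p →
  suc ∣ p ∣ ≤ ∣ q ∣ + ∣ p ─ q ∣
removeProtruding {x = x} {p} {q} x∈q x∉p = begin
  suc ∣ p ∣                    ≡⟨ cong suc (∣p∣≡∣p∩q∣+∣p─q∣ p q) ⟩
  suc ∣ p ∩ q ∣ + ∣ p ─ q ∣    ≤⟨ +-monoˡ-≤ _ (s≤s (p⊆q⇒∣p∣≤∣q∣ p∩q⊆q-x)) ⟩
  suc ∣ q - x ∣ + ∣ p ─ q ∣    ≤⟨ +-monoˡ-≤ _ (x∈p⇒∣p-x∣<∣p∣ x∈q) ⟩
  ∣ q ∣ + ∣ p ─ q ∣            ∎
  where
  open ≤-Reasoning
  p∩q⊆q-x : p ∩ q ⊆ q - x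
  p∩q⊆q-x y∈p∩q with x∈p∩q⁻ p q y∈p∩q
  ... | y∈p , y∈q = x∈p∧x≢y⇒x∈p-y y∈q λ { refl → x∉p y∈p }

element : ∀ {n} (p : Subset n) → 1 ≤ ∣ p ∣ → ∃ λ x → x ∈ p
element (inside ∷ p)  _  = zero , here
element (outside ∷ p) 1≤ with element p 1≤
... | x , x∈p = suc x , there x∈p

pick : ∀ {n} k (p : Subset n) → k ≤ ∣ p ∣ → ∃ λ q → q ⊆ p × ∣ q ∣ ≡ k
pick {n} zero p _ = ⊥ , ⊆-min p , ∣⊥∣≡0 n
pick (suc k) (inside ∷ p) (s≤s k≤) with pick k p k≤
... | q , q⊆p , ∣q∣ = inside ∷ q , in⊆in q⊆p , cong suc ∣q∣
pick (suc k) (outside ∷ p) k≤ with pick (suc k) p k≤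
... | q , q⊆p , ∣q∣ = outside ∷ q , out⊆ q⊆p , ∣q∣

extend : ∀ {n k} {r p : Subset n} → r ⊆ p → ∣ r ∣ ≤ k → k ≤ ∣ p ∣ →
  ∃ λ t → r ⊆ t × t ⊆ p × ∣ t ∣ ≡ k
extend {k = k} {r} {p} r⊆p ∣r∣≤k k≤∣p∣ with pick (k ∸ ∣ r ∣) (p ─ r) room
  where
  room : k ∸ ∣ r ∣ ≤ ∣ p ─ r ∣
  room = m≤n+o⇒m∸n≤o k ∣ r ∣ (subst (k ≤_) (∣p∣≡∣q∣+∣p─q∣ r⊆p) k≤∣p∣)
... | z , z⊆p─r , ∣z∣ =
  r ∪ z , p⊆p∪q z , ⊆-∪ r⊆p (⊆-trans z⊆p─r (p─q⊆p p r)) ,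
  trans (∣p∪q∣≡∣p∣+∣q∣ (Dj-⊆ ⊆-refl z⊆p─r Dj-─)) (trans (cong (∣ r ∣ +_) ∣z∣) (m+[n∸m]≡n ∣r∣≤k))

record Packing {n} (j : ℕ) (X Y : Subset n) : Set where
  field
    edge     : Fin j → Subset n
    size     : ∀ i → ∣ edge i ∣ ≡ 3
    within   : ∀ i → edge i ⊆ X ∪ Y
    meets    : ∀ i → ∃ λ y → y ∈ edge i × y ∈ Y
    disjoint : ∀ i i′ → i ≢ i′ → Dj (edge i) (edge i′)

-- Disjoint X, Y with ∣ X ∣ ≥ 2j and ∣ Y ∣ ≥ j admit such a packing: each edge
-- takes one point of Y and two of X, and the rest is packed recursively.
packing : ∀ {n} j (X Y : Subset n) → Dj X Y → j * 2 ≤ ∣ X ∣ → j ≤ ∣ Y ∣ → Packing j X Y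
packing zero X Y _ _ _ = record
  { edge = λ () ; size = λ () ; within = λ () ; meets = λ () ; disjoint = λ () }
packing (suc j) X Y X∩Y=∅ 2j+2≤∣X∣ j+1≤∣Y∣
  with element Y (≤-trans (s≤s z≤n) j+1≤∣Y∣) | pick 2 X (≤-trans (s≤s (s≤s z≤n)) 2j+2≤∣X∣)
... | y , y∈Y | D , D⊆X , ∣D∣ = record
  { edge = edge′ ; size = size′ ; within = within′ ; meets = meets′ ; disjoint = disjoint′ }
  where
  X′ Y′ new : Subset _
  X′  = X ─ D
  Y′  = Y - y
  new = ⁅ y ⁆ ∪ D

  ⁅y⁆⊆Y : ⁅ y ⁆ ⊆ Y
  ⁅y⁆⊆Y = ⁅x⁆⊆p y∈Y

  rest : Packing j X′ Y′
  rest = packing j X′ Y′ (Dj-⊆ (p─q⊆p X D) (p─q⊆p Y ⁅ y ⁆) X∩Y=∅)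
           (shrink D⊆X ∣D∣ 2j+2≤∣X∣) (shrink ⁅y⁆⊆Y (∣⁅x⁆∣≡1 y) j+1≤∣Y∣)
  open Packing rest

  new-rest : Dj new (X′ ∪ Y′)
  new-rest = Dj-∪ˡ (Dj-∪ʳ (Dj-⊆ ⁅y⁆⊆Y (p─q⊆p X D) (Dj-sym X∩Y=∅)) Dj-─)
                   (Dj-∪ʳ Dj-─ (Dj-⊆ D⊆X (p─q⊆p Y ⁅ y ⁆) X∩Y=∅))

  edge′ : Fin (suc j) → Subset _
  edge′ zero    = new
  edge′ (suc i) = edge i

  size′ : ∀ i → ∣ edge′ i ∣ ≡ 3
  size′ zero    = trans (∣p∪q∣≡∣p∣+∣q∣ (Dj-⊆ ⁅y⁆⊆Y D⊆X (Dj-sym X∩Y=∅))) (cong₂ _+_ (∣⁅x⁆∣≡1 y) ∣D∣)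
  size′ (suc i) = size i

  within′ : ∀ i → edge′ i ⊆ X ∪ Y
  within′ zero    = ⊆-∪ (⊆-trans ⁅y⁆⊆Y (q⊆p∪q X Y)) (⊆-trans D⊆X (p⊆p∪q Y))
  within′ (suc i) = ⊆-trans (within i)
    (⊆-∪ (⊆-trans (p─q⊆p X D) (p⊆p∪q Y)) (⊆-trans (p─q⊆p Y ⁅ y ⁆) (q⊆p∪q X Y)))

  meets′ : ∀ i → ∃ λ z → z ∈ edge′ i × z ∈ Y
  meets′ zero    = y , x∈p∪q⁺ (inj₁ (x∈⁅x⁆ y)) , y∈Y
  meets′ (suc i) with meets i
  ... | z , z∈edge , z∈Y′ = z , z∈edge , p─q⊆p Y ⁅ y ⁆ z∈Y′

  disjoint′ : ∀ i i′ → i ≢ i′ → Dj (edge′ i) (edge′ i′)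
  disjoint′ zero    zero     i≢i′ = ⊥-elim (i≢i′ refl)
  disjoint′ zero    (suc i′) _    = Dj-⊆ ⊆-refl (within i′) new-rest
  disjoint′ (suc i) zero     _    = Dj-sym (Dj-⊆ ⊆-refl (within i) new-rest)
  disjoint′ (suc i) (suc i′) i≢i′ = disjoint i i′ (λ i≡i′ → i≢i′ (cong suc i≡i′))

twoOthers : (k : Fin 3) → ∃₂ λ x y → ∀ a → a ≢ k → a ≡ x ⊎ a ≡ y
twoOthers zero = suc zero , suc (suc zero) , λ
  { zero a≢k → ⊥-elim (a≢k refl) ; (suc zero) _ → inj₁ refl ; (suc (suc zero)) _ → inj₂ refl }
twoOthers (suc zero) = zero , suc (suc zero) , λ
  { zero _ → inj₁ refl ; (suc zero) a≢k → ⊥-elim (a≢k refl) ; (suc (suc zero)) _ → inj₂ refl }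
twoOthers (suc (suc zero)) = zero , suc zero , λ
  { zero _ → inj₁ refl ; (suc zero) _ → inj₂ refl ; (suc (suc zero)) a≢k → ⊥-elim (a≢k refl) }

module _ (c : Colouring) where

  fourEdges : (e₁ e₂ e₃ e₄ : Subset 12) →
    IsEdge e₁ → IsEdge e₂ → IsEdge e₃ → IsEdge e₄ →
    Dj e₁ e₂ → Dj e₁ e₃ → Dj e₁ e₄ → Dj e₂ e₃ → Dj e₂ e₄ → Dj e₃ e₄ →
    (x y : Fin 3) → (c e₁ ≡ x ⊎ c e₁ ≡ y) → (c e₂ ≡ x ⊎ c e₂ ≡ y) →
    (c e₃ ≡ x ⊎ c e₃ ≡ y) → (c e₄ ≡ x ⊎ c e₄ ≡ y) → FourDisjointTwoColoured c
  fourEdges e₁ e₂ e₃ e₄ ∣e₁∣ ∣e₂∣ ∣e₃∣ ∣e₄∣ d₁₂ d₁₃ d₁₄ d₂₃ d₂₄ d₃₄ x y c₁ c₂ c₃ c₄ =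
    e₁ , e₂ , e₃ , e₄ , (∣e₁∣ , ∣e₂∣ , ∣e₃∣ , ∣e₄∣) ,
    (Dj⇒Disjoint d₁₂ , Dj⇒Disjoint d₁₃ , Dj⇒Disjoint d₁₄ ,
     Dj⇒Disjoint d₂₃ , Dj⇒Disjoint d₂₄ , Dj⇒Disjoint d₃₄) ,
    x , y , c₁ , c₂ , c₃ , c₄

  -- Three disjoint edges of one colour k: their complement is a fourth
  -- disjoint edge (12 = 3 + 3 + 3 + 3), and only k and its colour occur.
  threeSameColour : ∀ {k} (e₁ e₂ e₃ : Subset 12) → IsEdge e₁ → IsEdge e₂ → IsEdge e₃ →
    Dj e₁ e₂ → Dj e₁ e₃ → Dj e₂ e₃ → c e₁ ≡ k → c e₂ ≡ k → c e₃ ≡ k →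
    FourDisjointTwoColoured c
  threeSameColour {k} e₁ e₂ e₃ ∣e₁∣ ∣e₂∣ ∣e₃∣ d₁₂ d₁₃ d₂₃ c₁ c₂ c₃ =
    fourEdges e₁ e₂ e₃ e₄ ∣e₁∣ ∣e₂∣ ∣e₃∣ ∣e₄∣
      d₁₂ d₁₃ (Dj-∁ e₁⊆covered) d₂₃ (Dj-∁ e₂⊆covered) (Dj-∁ e₃⊆covered)
      k (c e₄) (inj₁ c₁) (inj₁ c₂) (inj₁ c₃) (inj₂ refl)
    where
    covered e₄ : Subset 12
    covered = e₁ ∪ (e₂ ∪ e₃)
    e₄ = ∁ covered

    e₁⊆covered : e₁ ⊆ covered
    e₁⊆covered = p⊆p∪q (e₂ ∪ e₃)
    e₂⊆covered : e₂ ⊆ covered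
    e₂⊆covered = ⊆-trans (p⊆p∪q e₃) (q⊆p∪q e₁ (e₂ ∪ e₃))
    e₃⊆covered : e₃ ⊆ covered
    e₃⊆covered = ⊆-trans (q⊆p∪q e₂ e₃) (q⊆p∪q e₁ (e₂ ∪ e₃))

    ∣covered∣ : ∣ covered ∣ ≡ 9
    ∣covered∣ =
      trans (∣p∪q∣≡∣p∣+∣q∣ (Dj-∪ʳ d₁₂ d₁₃))
            (cong₂ _+_ ∣e₁∣ (trans (∣p∪q∣≡∣p∣+∣q∣ d₂₃) (cong₂ _+_ ∣e₂∣ ∣e₃∣)))

    ∣e₄∣ : IsEdge e₄
    ∣e₄∣ = trans (∣∁p∣≡n∸∣p∣ covered) (cong (12 ∸_) ∣covered∣)

  fourAvoiding : ∀ k (e : Fin 4 → Subset 12) → (∀ i → IsEdge (e i)) →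
    (∀ i i′ → i ≢ i′ → Dj (e i) (e i′)) → (∀ i → c (e i) ≢ k) →
    FourDisjointTwoColoured c
  fourAvoiding k e size disjoint avoid with twoOthers k
  ... | x , y , other =
    fourEdges (e 0F) (e 1F) (e 2F) (e 3F) (size 0F) (size 1F) (size 2F) (size 3F)
      (disjoint 0F 1F λ ()) (disjoint 0F 2F λ ()) (disjoint 0F 3F λ ())
      (disjoint 1F 2F λ ()) (disjoint 1F 3F λ ()) (disjoint 2F 3F λ ())
      x y (colour 0F) (colour 1F) (colour 2F) (colour 3F)
    where
    0F 1F 2F 3F : Fin 4
    0F = zero
    1F = suc zero
    2F = suc (suc zero)
    3F = suc (suc (suc zero))
    colour : ∀ i → c (e i) ≡ x ⊎ c (e i) ≡ y
    colour i = other (c (e i)) (avoid i)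

module SameColour (c : Colouring) (k : Fin 3) (S₁ S₂ : Subset 12)
  (∣S₁∣ : ∣ S₁ ∣ ≡ 6) (∣S₂∣ : ∣ S₂ ∣ ≡ 6)
  (mono₁ : ∀ T → T ⊆ S₁ → IsEdge T → c T ≡ k)
  (mono₂ : ∀ T → T ⊆ S₂ → IsEdge T → c T ≡ k) where

  3≤∣S₁∣ : 3 ≤ ∣ S₁ ∣
  3≤∣S₁∣ = subst (3 ≤_) (sym ∣S₁∣) (s≤s (s≤s (s≤s z≤n)))

  -- Overlap at most 3: S₁ splits into two k-edges and S₂ ─ S₁ contains a third.
  smallOverlap : ∣ S₁ ∩ S₂ ∣ ≤ 3 → FourDisjointTwoColoured c
  smallOverlap overlap≤3 with pick 3 S₁ 3≤∣S₁∣ | pick 3 (S₂ ─ S₁) room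
    where
    open ≤-Reasoning
    room : 3 ≤ ∣ S₂ ─ S₁ ∣
    room = +-cancelˡ-≤ 3 3 _ (begin
      6                          ≡⟨ sym ∣S₂∣ ⟩
      ∣ S₂ ∣                     ≡⟨ ∣p∣≡∣p∩q∣+∣p─q∣ S₂ S₁ ⟩
      ∣ S₂ ∩ S₁ ∣ + ∣ S₂ ─ S₁ ∣  ≤⟨ +-monoˡ-≤ _ (subst (_≤ 3) (cong ∣_∣ (∩-comm S₁ S₂)) overlap≤3) ⟩
      3 + ∣ S₂ ─ S₁ ∣            ∎)
  ... | e₁ , e₁⊆S₁ , ∣e₁∣ | e₃ , e₃⊆S₂─S₁ , ∣e₃∣ =
    threeSameColour c e₁ e₂ e₃ ∣e₁∣ ∣e₂∣ ∣e₃∣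
      Dj-─ (Dj-⊆ e₁⊆S₁ e₃⊆S₂─S₁ Dj-─) (Dj-⊆ (p─q⊆p S₁ e₁) e₃⊆S₂─S₁ Dj-─)
      (mono₁ e₁ e₁⊆S₁ ∣e₁∣) (mono₁ e₂ (p─q⊆p S₁ e₁) ∣e₂∣)
      (mono₂ e₃ (⊆-trans e₃⊆S₂─S₁ (p─q⊆p S₂ S₁)) ∣e₃∣)
    where
    e₂ : Subset 12
    e₂ = S₁ ─ e₁
    ∣e₂∣ : IsEdge e₂
    ∣e₂∣ = sym (+-cancelˡ-≡ 3 3 _
      (trans (sym ∣S₁∣) (trans (∣p∣≡∣q∣+∣p─q∣ e₁⊆S₁) (cong (_+ ∣ e₂ ∣) ∣e₁∣))))

  module OverlapFour (overlap≡4 : ∣ S₁ ∩ S₂ ∣ ≡ 4) where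

    U A : Subset 12
    U = S₁ ∪ S₂
    A = S₁ ─ S₂

    ∣U∣ : ∣ U ∣ ≡ 8
    ∣U∣ = +-cancelʳ-≡ 4 ∣ U ∣ 8
      (trans (cong (∣ U ∣ +_) (sym overlap≡4))
             (trans (∣p∪q∣+∣p∩q∣ S₁ S₂) (cong₂ _+_ ∣S₁∣ ∣S₂∣)))

    ∣∁U∣ : ∣ ∁ U ∣ ≡ 4
    ∣∁U∣ = trans (∣∁p∣≡n∸∣p∣ U) (cong (12 ∸_) ∣U∣)

    ∣A∣ : ∣ A ∣ ≡ 2
    ∣A∣ = sym (+-cancelˡ-≡ 4 2 _
      (trans (sym ∣S₁∣) (trans (∣p∣≡∣p∩q∣+∣p─q∣ S₁ S₂) (cong (_+ ∣ A ∣) overlap≡4))))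

    leftoverInS₂ : ∀ {E T} → A ─ E ⊆ T → (U ─ E) ─ T ⊆ S₂
    leftoverInS₂ {E} {T} A─E⊆T {x} x∈rest with x∈p∪q⁻ S₁ S₂ (p─q⊆p U E x∈U─E)
      where
      x∈U─E : x ∈ U ─ E
      x∈U─E = p─q⊆p (U ─ E) T x∈rest
    ... | inj₂ x∈S₂ = x∈S₂
    ... | inj₁ x∈S₁ with x ∈? S₂
    ...   | yes x∈S₂ = x∈S₂
    ...   | no  x∉S₂ = ⊥-elim (Dj-─ (A─E⊆T x∈A─E) x∈rest)
      where
      x∈A─E : x ∈ A ─ E
      x∈A─E = x∈p∧x∉q⇒x∈p─q (x∈p∧x∉q⇒x∈p─q x∈S₁ x∉S₂)
                (x∈p─q⇒x∉q U E (p─q⊆p (U ─ E) T x∈rest))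

    -- A k-edge E with a vertex y outside U: take T ⊆ S₁ ─ E of size 3
    -- containing A ─ E, then T′ of size 3 in (U ─ E) ─ T, which lies in S₂.
    kEdgeMeetingOutside : ∀ E → IsEdge E → c E ≡ k → (∃ λ y → y ∈ E × y ∈ ∁ U) →
      FourDisjointTwoColoured c
    kEdgeMeetingOutside E ∣E∣ cE≡k (y , y∈E , y∈∁U)
      with extend {k = 3} (─-monoˡ (p─q⊆p S₁ S₂)) ∣A─E∣≤3 3≤∣S₁─E∣
      where
      ∣A─E∣≤3 : ∣ A ─ E ∣ ≤ 3
      ∣A─E∣≤3 = ≤-trans (∣p─q∣≤∣p∣ A E) (≤-trans (≤-reflexive ∣A∣) (n≤1+n 2))

      3≤∣S₁─E∣ : 3 ≤ ∣ S₁ ─ E ∣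
      3≤∣S₁─E∣ = ≤-trans (n≤1+n 3) (+-cancelˡ-≤ 3 4 _
        (subst₂ (λ s e → suc s ≤ e + ∣ S₁ ─ E ∣) ∣S₁∣ ∣E∣
          (removeProtruding y∈E (λ y∈S₁ → x∈∁p⇒x∉p y∈∁U (p⊆p∪q S₂ y∈S₁)))))
    ... | T , A─E⊆T , T⊆S₁─E , ∣T∣ with pick 3 ((U ─ E) ─ T) 3≤∣rest∣
      where
      6≤∣U─E∣ : 6 ≤ ∣ U ─ E ∣
      6≤∣U─E∣ = +-cancelˡ-≤ 3 6 _
        (subst₂ (λ u e → suc u ≤ e + ∣ U ─ E ∣) ∣U∣ ∣E∣
          (removeProtruding y∈E (x∈∁p⇒x∉p y∈∁U)))

      3≤∣rest∣ : 3 ≤ ∣ (U ─ E) ─ T ∣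
      3≤∣rest∣ = shrink (⊆-trans T⊆S₁─E (─-monoˡ (p⊆p∪q S₂))) ∣T∣ 6≤∣U─E∣
    ... | T′ , T′⊆rest , ∣T′∣ =
      threeSameColour c E T T′ ∣E∣ ∣T∣ ∣T′∣
        (Dj-⊆ ⊆-refl T⊆S₁─E Dj-─) (Dj-⊆ ⊆-refl (⊆-trans T′⊆rest (p─q⊆p _ T)) Dj-─)
        (Dj-⊆ ⊆-refl T′⊆rest Dj-─)
        cE≡k (mono₁ T (⊆-trans T⊆S₁─E (p─q⊆p S₁ E)) ∣T∣)
        (mono₂ T′ (⊆-trans T′⊆rest (leftoverInS₂ A─E⊆T)) ∣T′∣)

    fromPacking : Packing 4 U (∁ U) → FourDisjointTwoColoured c
    fromPacking P = decide (any? (λ i → c (edge i) ≟ k))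
      where
      open Packing P
      decide : Dec (∃ λ i → c (edge i) ≡ k) → FourDisjointTwoColoured c
      decide (yes (i , cᵢ≡k)) = kEdgeMeetingOutside (edge i) (size i) cᵢ≡k (meets i)
      decide (no  noneIsK)    = fourAvoiding c k edge size disjoint (λ i cᵢ≡k → noneIsK (i , cᵢ≡k))

    overlapFour : FourDisjointTwoColoured c
    overlapFour =
      fromPacking (packing 4 U (∁ U) (Dj-∁ ⊆-refl) (≤-reflexive (sym ∣U∣)) (≤-reflexive (sym ∣∁U∣)))

  forced : ∣ S₁ ∩ S₂ ∣ ≤ 4 → FourDisjointTwoColoured c
  forced overlap≤4 with m≤n⇒m<n∨m≡n overlap≤4
  ... | inj₁ (s≤s overlap≤3) = smallOverlap overlap≤3
  ... | inj₂ overlap≡4       = OverlapFour.overlapFour overlap≡4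

mainTheorem9 : (c : Colouring) → ¬ FourDisjointTwoColoured c →
    (S₁ S₂ : Subset 12) (k₁ k₂ : Fin 3) →
    Monochromatic c S₁ k₁ → Monochromatic c S₂ k₂ →
    ∣ S₁ ∩ S₂ ∣ ≤ 4 → ¬ (k₁ ≡ k₂)
mainTheorem9 c noFour S₁ S₂ k .k (∣S₁∣ , mono₁) (∣S₂∣ , mono₂) overlap≤4 refl =
  noFour (SameColour.forced c k S₁ S₂ ∣S₁∣ ∣S₂∣ mono₁ mono₂ overlap≤4)
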